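{- Let $G=(V,E)$ be a countably infinite graph and $c$ an edge coloring of $G$. Let $\{C_j:j<k\}$ be a finite family of subsets of $V$ such that each $C_j$ is infinitely linked in some color $i_j$, and for $j<k$ let $A_j\subseteq C_j$ be arbitrary. Then there are pairwise disjoint vertex sets $P_j$ ($j<k$) such that (a) $P_j$ is a (finite or one-way infinite) path in color $i_j$ for every $j<k$; (b) if $A_j$ is infinite then so is $A_j\cap P_j$; (c) $\bigcup_{j<k}P_j\supseteq\bigcup_{j<k}C_j$. Moreover, for any choice of pairwise distinct points $x_j\in C_j$ for those $j$ with $C_j$ infinite, the paths can be chosen so that $P_j$ has first point $x_j$ for each such $j$.
   Context: A path is a finite or one-way infinite sequence of distinct vertices in which consecutive vertices are adjacent; a path in color $i$ is a path in the graph $(V,c^{ -1}(i))$ (all consecutive pairs are edges of color $i$). The empty set and singletons are paths in any color. A set $A\subseteq V$ is infinitely linked in color $i$ if in the graph $(V,c^{ -1}(i))$ there are infinitely many vertex-disjoint finite paths between any two distinct points of $A$ (equivalently, for any two distinct $v,w\in A$ and finite $F\subseteq V\setminus\{v,w\}$ there is a path of color $i$ from $v$ to $w$ avoiding $F$). -}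

module Defs where

open import Level using (0ℓ)
open import Data.Nat using (ℕ; suc)
open import Data.Fin using (Fin)
open import Data.Maybe using (Maybe; just; nothing)
open import Data.List using (List; []; _∷_; head; last)
open import Data.List.Membership.Propositional using (_∈_; _∉_)
open import Data.List.Relation.Unary.All using (All)
open import Data.List.Relation.Unary.Unique.Propositional using (Unique)
open import Data.List.Relation.Unary.Linked using (Linked)
open import Data.Product using (Σ; ∃; _×_)
open import Function.Definitions using (Injective)
open import Relation.Binary.PropositionalEquality using (_≡_; _≢_)
open import Relation.Nullary using (¬_)
open import Data.Empty using (⊥)

-- A countably infinite simple graph with an edge colouring into a set K of colours,
-- vertex set V = ℕ: c u v = just i iff {u,v} is an edge of colour i,
-- c u v = nothing iff u,v are not adjacent.
record EdgeColouredGraph (K : Set) : Set where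
  field
    c    : ℕ → ℕ → Maybe K
    symm : ∀ u v → c u v ≡ c v u
    irr  : ∀ v → c v v ≡ nothing

Subset : Set₁
Subset = ℕ → Set

_⊆_ : Subset → Subset → Set
A ⊆ B = ∀ v → A v → B v

Finite : Subset → Set
Finite A = ∃ λ (xs : List ℕ) → ∀ v → A v → v ∈ xs

Infinite : Subset → Set
Infinite A = ¬ Finite A

module _ {K : Set} (G : EdgeColouredGraph K) where
  open EdgeColouredGraph G

  Adj : K → ℕ → ℕ → Set
  Adj i u v = c u v ≡ just i

  IsFinPath : K → List ℕ → Set
  IsFinPath i xs = Unique xs × Linked (Adj i) xs

  data Path (i : K) : Set where
    finP : (xs : List ℕ) → IsFinPath i xs → Path i
    infP : (f : ℕ → ℕ) → Injective _≡_ _≡_ f → (∀ n → Adj i (f n) (f (suc n))) → Path i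

  _∈P_ : ∀ {i} → ℕ → Path i → Set
  v ∈P finP xs _   = v ∈ xs
  v ∈P infP f _ _  = ∃ λ n → f n ≡ v

  FirstPoint : ∀ {i} → Path i → ℕ → Set
  FirstPoint (finP xs _)  x = head xs ≡ just x
  FirstPoint (infP f _ _) x = f 0 ≡ x

  InfinitelyLinked : K → Subset → Set
  InfinitelyLinked i A =
    ∀ v w → A v → A w → v ≢ w → (F : List ℕ) → v ∉ F → w ∉ F →
    ∃ λ (xs : List ℕ) → IsFinPath i xs × head xs ≡ just v × last xs ≡ just w
                        × All (_∉ F) xs

  -- conditions (a),(b),(c) on a family of paths P_j (j<k); (a) is built into
  -- the type (P j : Path (col j)).
  GoodPaths : (k : ℕ) (col : Fin k → K) (C A : Fin k → Subset)
              (P : (j : Fin k) → Path (col j)) → Set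
  GoodPaths k col C A P =
      (∀ j j' → j ≢ j' → ∀ v → v ∈P P j → v ∈P P j' → ⊥)
    × (∀ j → Infinite (A j) → Infinite (λ v → A j v × v ∈P P j))
    × (∀ j v → C j v → ∃ λ j' → v ∈P P j')

module Submission where

-- We grow k disjoint finite paths, the j-th ending in C_j, in stages
-- m = 0, 1, 2, ...  In stage m each path j in turn is extended
--   (1) to a fresh vertex of A_j that is ≥ m, if there is one, and then
--   (2) to the vertex m, if m ∈ C_j and m is not yet on any path.
-- An extension from the end u ∈ C_j to a fresh v ∈ C_j is possible because C_j is
-- infinitely linked: some u–v path of colour i_j avoids all other used vertices.
-- For each j the finite paths form a prefix chain; its limit (a finite or a one-way
-- infinite path, decided classically) is P_j.  Disjointness survives the limit,
-- step (1) makes A_j ∩ P_j unbounded, step (2) puts every vertex of C_j on some path.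

open import Defs
open import Level using (0ℓ)
open import Axiom.ExcludedMiddle using (ExcludedMiddle)
open import Data.Nat
  using (ℕ; zero; suc; _≤_; _<_; _≤?_; _≟_; z≤n; s≤s; _⊔_; _≤′_; ≤′-refl; ≤′-step)
open import Data.Nat.Properties
  using (≤-trans; ≤-total; ≮⇒≥; m≤m+n; ≤⇒≤′; <⇒≱; ≰⇒>; n≤1+n; m≤m⊔n; m≤n⊔m)
open import Data.Fin using (Fin) renaming (_≟_ to _≟ᶠ_)
open import Data.Maybe using (just)
open import Data.Maybe.Properties using (just-injective)
open import Data.Maybe.Relation.Binary.Connected using (Connected; just)
open import Data.List using (List; []; _∷_; head; last; length; _++_; filter; concat; tabulate; upTo; allFin)
open import Data.List.Properties using (++-identityʳ; ++-assoc; length-++)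
open import Data.List.Membership.Propositional using (_∈_; _∉_)
open import Data.List.Membership.Propositional.Properties
  using (∈-++⁺ˡ; ∈-++⁺ʳ; ∈-++⁻; ∈-filter⁺; ∈-filter⁻; ∈-concat⁺′; ∈-concat⁻′;
         ∈-tabulate⁺; ∈-tabulate⁻; ∈-upTo⁺; ∈-allFin)
open import Data.List.Membership.DecPropositional _≟_ using (_∈?_)
open import Data.List.Relation.Unary.Any using (here; there)
open import Data.List.Relation.Unary.All as All using (All; []; _∷_)
open import Data.List.Relation.Unary.AllPairs using ([]; _∷_)
open import Data.List.Relation.Unary.Unique.Propositional using (Unique)
open import Data.List.Relation.Unary.Linked using (Linked; []; [-]; _∷_)
import Data.List.Relation.Unary.Linked.Properties as Linked
import Data.List.Relation.Unary.Unique.Propositional.Properties as Unique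
open import Data.List.Extrema.Nat using (max; xs≤max)
open import Data.Vec.Functional using (updateAt)
open import Data.Vec.Functional.Properties using (updateAt-updates; updateAt-minimal)
open import Data.Product using (Σ; ∃; _×_; _,_; proj₁; proj₂)
open import Data.Sum using (_⊎_; inj₁; inj₂; map₂)
open import Data.Empty using (⊥; ⊥-elim)
open import Function using (_∘_)
open import Relation.Binary.PropositionalEquality
  using (_≡_; _≢_; refl; sym; trans; cong; subst)
open import Relation.Nullary using (¬_; Dec; yes; no; ¬?)

module _ {A : Set} where

  _≼_ : List A → List A → Set
  xs ≼ ys = ∃ λ zs → xs ++ zs ≡ ys

  ≼-refl : ∀ xs → xs ≼ xs
  ≼-refl xs = [] , ++-identityʳ xs

  ≼-trans : ∀ {xs ys zs} → xs ≼ ys → ys ≼ zs → xs ≼ zs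
  ≼-trans {xs} (as , refl) (bs , refl) = as ++ bs , sym (++-assoc xs as bs)

  ≼-∈ : ∀ {xs ys v} → xs ≼ ys → v ∈ xs → v ∈ ys
  ≼-∈ (_ , refl) = ∈-++⁺ˡ

  ≼-length : ∀ {xs ys} → xs ≼ ys → length xs ≤ length ys
  ≼-length {xs} (zs , refl) = subst (length xs ≤_) (sym (length-++ xs)) (m≤m+n (length xs) (length zs))

  ≼-head : ∀ {xs ys x} → xs ≼ ys → head xs ≡ just x → head ys ≡ just x
  ≼-head {_ ∷ _} (_ , refl) h = h

  chain-mono : (T : ℕ → List A) → (∀ n → T n ≼ T (suc n)) → ∀ {m n} → m ≤ n → T m ≼ T n
  chain-mono T step = go ∘ ≤⇒≤′
    where
    go : ∀ {m n} → m ≤′ n → T m ≼ T n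
    go ≤′-refl = ≼-refl _
    go {n = suc n} (≤′-step m≤′n) = ≼-trans (go m≤′n) (step n)

  last-nonempty : ∀ (x : A) xs → ∃ λ u → last (x ∷ xs) ≡ just u
  last-nonempty x [] = x , refl
  last-nonempty x (y ∷ xs) = last-nonempty y xs

  last-∈ : ∀ {u} (xs : List A) → last xs ≡ just u → u ∈ xs
  last-∈ (x ∷ []) refl = here refl
  last-∈ (x ∷ y ∷ xs) h = there (last-∈ (y ∷ xs) h)

  last-++ : ∀ (xs : List A) r rs → last (xs ++ r ∷ rs) ≡ last (r ∷ rs)
  last-++ [] r rs = refl
  last-++ (x ∷ []) r rs = refl
  last-++ (x ∷ y ∷ xs) r rs = last-++ (y ∷ xs) r rs

-- The m-th vertex of a list (0 beyond its end); used to read off a one-way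
-- infinite path from a chain of finite ones.
nth : ℕ → List ℕ → ℕ
nth _ [] = 0
nth zero (x ∷ xs) = x
nth (suc m) (x ∷ xs) = nth m xs

nth-∈ : ∀ m xs → m < length xs → nth m xs ∈ xs
nth-∈ zero (x ∷ xs) _ = here refl
nth-∈ (suc m) (x ∷ xs) (s≤s m<) = there (nth-∈ m xs m<)

∈-nth : ∀ {v} xs → v ∈ xs → ∃ λ m → m < length xs × nth m xs ≡ v
∈-nth (x ∷ xs) (here refl) = 0 , s≤s z≤n , refl
∈-nth (x ∷ xs) (there v∈) with ∈-nth xs v∈
... | m , m< , eq = suc m , s≤s m< , eq

≼-nth : ∀ {xs ys} m → xs ≼ ys → m < length xs → nth m ys ≡ nth m xs
≼-nth {xs} m (zs , refl) = go m xs
  where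
  go : ∀ m xs → m < length xs → nth m (xs ++ zs) ≡ nth m xs
  go zero (x ∷ xs) _ = refl
  go (suc m) (x ∷ xs) (s≤s m<) = go m xs m<

nth-head : ∀ {x} xs → head xs ≡ just x → nth 0 xs ≡ x
nth-head (y ∷ xs) refl = refl

nth-injective : ∀ xs → Unique xs → ∀ {a b} → a < length xs → b < length xs →
                nth a xs ≡ nth b xs → a ≡ b
nth-injective (x ∷ xs) _ {zero} {zero} _ _ _ = refl
nth-injective (x ∷ xs) (x∉ ∷ _) {zero} {suc b} _ (s≤s b<) eq =
  ⊥-elim (All.lookup x∉ (nth-∈ b xs b<) eq)
nth-injective (x ∷ xs) (x∉ ∷ _) {suc a} {zero} (s≤s a<) _ eq =
  ⊥-elim (All.lookup x∉ (nth-∈ a xs a<) (sym eq))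
nth-injective (x ∷ xs) (_ ∷ u) {suc a} {suc b} (s≤s a<) (s≤s b<) eq =
  cong suc (nth-injective xs u a< b< eq)

nth-linked : ∀ {R : ℕ → ℕ → Set} xs → Linked R xs → ∀ m → suc m < length xs →
             R (nth m xs) (nth (suc m) xs)
nth-linked (x ∷ []) [-] m (s≤s ())
nth-linked (x ∷ y ∷ xs) (r ∷ _) zero _ = r
nth-linked (x ∷ y ∷ xs) (_ ∷ l) (suc m) (s≤s m<) = nth-linked (y ∷ xs) l m m<

-- Classically, an infinite set of naturals has elements above any bound outside
-- any finite list: otherwise it would be covered by U ++ [0 .. m-1].
fresh-element : ExcludedMiddle 0ℓ → {X : Subset} → Infinite X →
                (U : List ℕ) (m : ℕ) → ∃ λ v → X v × m ≤ v × v ∉ U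
fresh-element em {X} infinite U m with em {∃ λ v → X v × m ≤ v × v ∉ U}
... | yes found = found
... | no none = ⊥-elim (infinite (U ++ upTo m , covered))
  where
  covered : ∀ v → X v → v ∈ U ++ upTo m
  covered v x with v ∈? U | m ≤? v
  ... | yes v∈U | _ = ∈-++⁺ˡ v∈U
  ... | no v∉U | yes m≤v = ⊥-elim (none (v , x , m≤v , v∉U))
  ... | no _ | no m≰v = ∈-++⁺ʳ U (∈-upTo⁺ (≰⇒> m≰v))

-- Conversely a set with elements above every bound is infinite: a finite list
-- covering it would bound it by its maximum.
unbounded⇒infinite : {X : Subset} → (∀ m → ∃ λ v → X v × m ≤ v) → Infinite X
unbounded⇒infinite unbounded (xs , covers) with unbounded (suc (max 0 xs))
... | v , x , bound<v = <⇒≱ bound<v (All.lookup (xs≤max 0 xs) (covers v x))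

module _ {K : Set} (G : EdgeColouredGraph K) where

  _∈ₚ_ : ∀ {i} → ℕ → Path G i → Set
  v ∈ₚ P = _∈P_ G v P

  -- In an infinitely linked set, distinct u and v ∉ U are joined by a path
  -- u ∷ rest whose vertices after u avoid U (u itself may lie in U): link u to v
  -- avoiding U without u, and note that rest cannot revisit u.
  link-avoiding : ∀ {i Z u v} → InfinitelyLinked G i Z → Z u → Z v → u ≢ v →
                  (U : List ℕ) → v ∉ U →
                  ∃ λ rest → IsFinPath G i (u ∷ rest) × last (u ∷ rest) ≡ just v × All (_∉ U) rest
  link-avoiding {i} {u = u} {v} linked zu zv u≢v U v∉U =
    fromLink (linked u v zu zv u≢v U-u u∉U-u (v∉U ∘ ∈U-u⇒∈U))
    where
    ≢u? : (w : ℕ) → Dec (w ≢ u)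
    ≢u? w = ¬? (w ≟ u)
    U-u : List ℕ
    U-u = filter ≢u? U
    ∈U-u⇒∈U : ∀ {w} → w ∈ U-u → w ∈ U
    ∈U-u⇒∈U = proj₁ ∘ ∈-filter⁻ ≢u? {xs = U}
    u∉U-u : u ∉ U-u
    u∉U-u u∈ = proj₂ (∈-filter⁻ ≢u? {xs = U} u∈) refl
    fromLink : (∃ λ xs → IsFinPath G i xs × head xs ≡ just u × last xs ≡ just v ×
                         All (_∉ U-u) xs) →
               ∃ λ rest → IsFinPath G i (u ∷ rest) × last (u ∷ rest) ≡ just v × All (_∉ U) rest
    fromLink (_ ∷ rest , path@(u∉rest ∷ _ , _) , refl , ends , _ ∷ rest∉U-u) =
      rest , path , ends , All.tabulate avoids
      where
      avoids : ∀ {w} → w ∈ rest → w ∉ U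
      avoids w∈ w∈U = All.lookup rest∉U-u w∈ (∈-filter⁺ ≢u? w∈U (All.lookup u∉rest w∈ ∘ sym))

  glue : ∀ {i xs u r rs} → IsFinPath G i xs → last xs ≡ just u → IsFinPath G i (u ∷ r ∷ rs) →
         (∀ {w} → w ∈ xs → w ∉ r ∷ rs) → IsFinPath G i (xs ++ r ∷ rs)
  glue {i} {xs} {u} {r} (unique , linked) ends (_ ∷ tailUnique , adj ∷ tailLinked) new =
    Unique.++⁺ unique tailUnique (λ (w∈xs , w∈rest) → new w∈xs w∈rest) ,
    Linked.++⁺ linked connected tailLinked
    where
    connected : Connected (Adj G i) (last xs) (just r)
    connected rewrite ends = just adj

  extend-path : ∀ {i Z v} → InfinitelyLinked G i Z → (U xs : List ℕ) → IsFinPath G i xs →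
                (∀ {u} → last xs ≡ just u → Z u) → (∀ {w} → w ∈ xs → w ∈ U) → Z v → v ∉ U →
                ∃ λ rest → IsFinPath G i (xs ++ rest) × last (xs ++ rest) ≡ just v × All (_∉ U) rest
  extend-path {v = v} _ _ [] _ _ _ _ v∉U = v ∷ [] , ([] ∷ [] , [-]) , refl , v∉U ∷ []
  extend-path {v = v} linked U (x ∷ xs) path endsInZ xs⊆U zv v∉U
    with last-nonempty x xs
  ... | u , ends with u ≟ v
  ... | yes refl = ⊥-elim (v∉U (xs⊆U (last-∈ (x ∷ xs) ends)))
  ... | no u≢v with link-avoiding linked (endsInZ ends) zv u≢v U v∉U
  ... | [] , _ , reachesV , _ = ⊥-elim (u≢v (just-injective reachesV))
  ... | r ∷ rs , link , reachesV , new =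
    r ∷ rs ,
    glue path ends link (λ w∈xs w∈rest → All.lookup new w∈rest (xs⊆U w∈xs)) ,
    trans (last-++ (x ∷ xs) r rs) reachesV ,
    new

  record IsLimit {i : K} (T : ℕ → List ℕ) (P : Path G i) : Set where
    field
      stage⊆limit  : ∀ {n v} → v ∈ T n → v ∈ₚ P
      limit⊆stages : ∀ {v} → v ∈ₚ P → ∃ λ n → v ∈ T n
      first        : ∀ {x} → head (T 0) ≡ just x → FirstPoint G P x

  -- If the lengths are
  -- bounded the chain stabilises at a longest member; otherwise its m-th vertex is
  -- eventually fixed and these vertices form a one-way infinite path.
  module ChainLimit (em : ExcludedMiddle 0ℓ) {i : K} (T : ℕ → List ℕ)
                    (isPath : ∀ n → IsFinPath G i (T n)) (step : ∀ n → T n ≼ T (suc n)) where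

    L : ℕ → ℕ
    L n = length (T n)

    mono : ∀ {m n} → m ≤ n → T m ≼ T n
    mono = chain-mono T step

    agree : ∀ {m} a b → m < L a → m < L b → nth m (T a) ≡ nth m (T b)
    agree {m} a b m<a m<b with ≤-total a b
    ... | inj₁ a≤b = sym (≼-nth m (mono a≤b) m<a)
    ... | inj₂ b≤a = ≼-nth m (mono b≤a) m<b

    -- Bounded lengths: the limit is the finite path T N of maximal length, which
    -- contains every T n since T n agrees with T N at all positions of T n.
    module Stabilising (N : ℕ) (longest : ∀ n → L n ≤ L N) where

      limit : Σ (Path G i) (IsLimit T)
      limit = finP (T N) (isPath N) , record
        { stage⊆limit  = stage⊆T-N
        ; limit⊆stages = λ v∈ → N , v∈
        ; first        = ≼-head (mono z≤n)
        }
        where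
        stage⊆T-N : ∀ {n v} → v ∈ T n → v ∈ T N
        stage⊆T-N {n} v∈ with ∈-nth (T n) v∈
        ... | m , m< , refl =
          subst (_∈ T N) (agree N n m<N m<) (nth-∈ m (T N) m<N)
          where
          m<N : m < L N
          m<N = ≤-trans m< (longest n)

    module Growing (unbounded : ¬ ∃ λ N → ∀ n → L n ≤ L N) where

      longer : ∀ N → ∃ λ n → L N < L n
      longer N with em {∃ λ n → L N < L n}
      ... | yes found = found
      ... | no none = ⊥-elim (unbounded (N , λ n → ≮⇒≥ (λ N<n → none (n , N<n))))

      long : ∀ m → ∃ λ n → m < L n
      long zero with longer 0
      ... | n , 0<n = n , ≤-trans (s≤s z≤n) 0<n
      long (suc m) with long m
      ... | n , m<n with longer n
      ... | n′ , n<n′ = n′ , ≤-trans (s≤s m<n) n<n′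

      reach : ℕ → ℕ
      reach m = proj₁ (long m)

      reach-long : ∀ m {n} → reach m ≤ n → m < L n
      reach-long m reach≤n = ≤-trans (proj₂ (long m)) (≼-length (mono reach≤n))

      f : ℕ → ℕ
      f m = nth m (T (reach m))

      f-agree : ∀ {m} a → m < L a → f m ≡ nth m (T a)
      f-agree {m} a m<a = agree (reach m) a (proj₂ (long m)) m<a

      f-injective : ∀ {a b} → f a ≡ f b → a ≡ b
      f-injective {a} {b} eq =
        nth-injective (T N) (proj₁ (isPath N)) a<N b<N
          (trans (sym (f-agree N a<N)) (trans eq (f-agree N b<N)))
        where
        N : ℕ
        N = reach a ⊔ reach b
        a<N : a < L N
        a<N = reach-long a (m≤m⊔n (reach a) (reach b))
        b<N : b < L N
        b<N = reach-long b (m≤n⊔m (reach a) (reach b))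

      f-adjacent : ∀ m → Adj G i (f m) (f (suc m))
      f-adjacent m rewrite f-agree (reach (suc m)) (≤-trans (n≤1+n (suc m)) (proj₂ (long (suc m)))) =
        nth-linked (T (reach (suc m))) (proj₂ (isPath (reach (suc m)))) m (proj₂ (long (suc m)))

      limit : Σ (Path G i) (IsLimit T)
      limit = infP f f-injective f-adjacent , record
        { stage⊆limit  = stage⊆limit
        ; limit⊆stages = λ { (m , refl) → reach m , nth-∈ m (T (reach m)) (proj₂ (long m)) }
        ; first        = λ h → nth-head (T (reach 0)) (≼-head (mono z≤n) h)
        }
        where
        stage⊆limit : ∀ {n v} → v ∈ T n → ∃ λ m → f m ≡ v
        stage⊆limit {n} v∈ with ∈-nth (T n) v∈
        ... | m , m< , eq = m , trans (f-agree n m<) eq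

    limit : Σ (Path G i) (IsLimit T)
    limit with em {∃ λ N → ∀ n → L n ≤ L N}
    ... | yes (N , longest) = Stabilising.limit N longest
    ... | no unbounded = Growing.limit unbounded

  chain-limit : ExcludedMiddle 0ℓ → ∀ {i} (T : ℕ → List ℕ) → (∀ n → IsFinPath G i (T n)) →
                (∀ n → T n ≼ T (suc n)) → Σ (Path G i) (IsLimit T)
  chain-limit = ChainLimit.limit

  module Construction (em : ExcludedMiddle 0ℓ) (k : ℕ) (C : Fin k → Subset) (col : Fin k → K)
                      (linked : ∀ j → InfinitelyLinked G (col j) (C j))
                      (A : Fin k → Subset) (A⊆C : ∀ j → A j ⊆ C j) where

    Family : Set
    Family = Fin k → List ℕ

    used : Family → List ℕ
    used s = concat (tabulate s)

    ∈-used⁺ : ∀ s j {v} → v ∈ s j → v ∈ used s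
    ∈-used⁺ s j v∈ = ∈-concat⁺′ v∈ (∈-tabulate⁺ j)

    ∈-used⁻ : ∀ s {v} → v ∈ used s → ∃ λ j → v ∈ s j
    ∈-used⁻ s v∈ with ∈-concat⁻′ (tabulate s) v∈
    ... | _ , v∈xs , xs∈ with ∈-tabulate⁻ xs∈
    ... | j , refl = j , v∈xs

    record Valid (s : Family) : Set where
      field
        isPath   : ∀ j → IsFinPath G (col j) (s j)
        endsInC  : ∀ j {u} → last (s j) ≡ just u → C j u
        disjoint : ∀ j j′ → j ≢ j′ → ∀ v → v ∈ s j → v ∈ s j′ → ⊥
    open Valid

    Config : Set
    Config = Σ Family Valid

    record _⊑_ (g g′ : Config) : Set where
      constructor extends
      field prefixes : ∀ j → proj₁ g j ≼ proj₁ g′ j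
    open _⊑_

    ⊑-refl : ∀ {g} → g ⊑ g
    ⊑-refl = extends (λ j → ≼-refl _)

    ⊑-trans : ∀ {g g′ g″} → g ⊑ g′ → g′ ⊑ g″ → g ⊑ g″
    ⊑-trans g⊑g′ g′⊑g″ = extends (λ j → ≼-trans (prefixes g⊑g′ j) (prefixes g′⊑g″ j))

    used-mono : ∀ {g g′ v} → g ⊑ g′ → v ∈ used (proj₁ g) → v ∈ used (proj₁ g′)
    used-mono {g} {g′} g⊑g′ v∈ with ∈-used⁻ (proj₁ g) v∈
    ... | j , v∈j = ∈-used⁺ (proj₁ g′) j (≼-∈ (prefixes g⊑g′ j) v∈j)

    module Extension (s : Family) (valid : Valid s) (j : Fin k) {v : ℕ}
                     (cv : C j v) (fresh : v ∉ used s) where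

      extension : ∃ λ rest → IsFinPath G (col j) (s j ++ rest) ×
                             last (s j ++ rest) ≡ just v × All (_∉ used s) rest
      extension = extend-path (linked j) (used s) (s j) (isPath valid j)
                    (endsInC valid j) (∈-used⁺ s j) cv fresh

      rest : List ℕ
      rest = proj₁ extension

      extended-path : IsFinPath G (col j) (s j ++ rest)
      extended-path = proj₁ (proj₂ extension)

      extended-ends : last (s j ++ rest) ≡ just v
      extended-ends = proj₁ (proj₂ (proj₂ extension))

      rest-fresh : All (_∉ used s) rest
      rest-fresh = proj₂ (proj₂ (proj₂ extension))

      s′ : Family
      s′ = updateAt s j (_++ rest)

      updated : (Q : Fin k → List ℕ → Set) → Q j (s j ++ rest) →
                (∀ j′ → j′ ≢ j → Q j′ (s j′)) → ∀ j′ → Q j′ (s′ j′)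
      updated Q atJ elsewhere j′ with j′ ≟ᶠ j
      ... | yes refl = subst (Q j) (sym (updateAt-updates j s)) atJ
      ... | no j′≢j = subst (Q j′) (sym (updateAt-minimal j′ j s j′≢j)) (elsewhere j′ j′≢j)

      ∈-s′ : ∀ j′ {w} → w ∈ s′ j′ → w ∈ s j′ ⊎ (j′ ≡ j × w ∈ rest)
      ∈-s′ = updated (λ j′ xs → ∀ {w} → w ∈ xs → w ∈ s j′ ⊎ (j′ ≡ j × w ∈ rest))
               (λ w∈ → map₂ (refl ,_) (∈-++⁻ (s j) w∈)) (λ _ _ → inj₁)

      valid′ : Valid s′
      valid′ = record
        { isPath   = updated (IsFinPath G ∘ col) extended-path (λ j′ _ → isPath valid j′)
        ; endsInC  = updated (λ j′ xs → ∀ {u} → last xs ≡ just u → C j′ u)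
                       (λ endsU → subst (C j) (just-injective (trans (sym extended-ends) endsU)) cv)
                       (λ j′ _ → endsInC valid j′)
        ; disjoint = disjoint′
        }
        where
        new : ∀ {w} → w ∈ rest → ∀ j′ → w ∉ s j′
        new w∈rest j′ w∈ = All.lookup rest-fresh w∈rest (∈-used⁺ s j′ w∈)
        disjoint′ : ∀ j₁ j₂ → j₁ ≢ j₂ → ∀ w → w ∈ s′ j₁ → w ∈ s′ j₂ → ⊥
        disjoint′ j₁ j₂ j₁≢j₂ w w∈₁ w∈₂ with ∈-s′ j₁ w∈₁ | ∈-s′ j₂ w∈₂
        ... | inj₁ old₁ | inj₁ old₂ = disjoint valid j₁ j₂ j₁≢j₂ w old₁ old₂
        ... | inj₁ old₁ | inj₂ (_ , w∈rest) = new w∈rest j₁ old₁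
        ... | inj₂ (_ , w∈rest) | inj₁ old₂ = new w∈rest j₂ old₂
        ... | inj₂ (refl , _) | inj₂ (refl , _) = j₁≢j₂ refl

      extended : Config
      extended = s′ , valid′

      grows : (s , valid) ⊑ extended
      grows = extends (updated (λ j′ xs → s j′ ≼ xs) (rest , refl) (λ j′ _ → ≼-refl (s j′)))

      reaches : v ∈ s′ j
      reaches = subst (v ∈_) (sym (updateAt-updates j s)) (last-∈ (s j ++ rest) extended-ends)

    FreshFor : Config → Fin k → (ℕ → Set) → Set
    FreshFor g j T = ∃ λ v → T v × C j v × v ∉ used (proj₁ g)

    offerBy : (g : Config) (j : Fin k) (T : ℕ → Set) → Dec (FreshFor g j T) → Config
    offerBy (s , valid) j T (yes (v , _ , cv , fresh)) = Extension.extended s valid j cv fresh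
    offerBy g j T (no _) = g

    offer : Config → Fin k → (ℕ → Set) → Config
    offer g j T = offerBy g j T em

    offer-⊑ : ∀ g j T → g ⊑ offer g j T
    offer-⊑ g j T with em {FreshFor g j T}
    ... | yes (v , _ , cv , fresh) = Extension.grows (proj₁ g) (proj₂ g) j cv fresh
    ... | no _ = ⊑-refl

    offer-reaches : ∀ g j T → FreshFor g j T → ∃ λ v → T v × v ∈ proj₁ (offer g j T) j
    offer-reaches g j T candidate with em {FreshFor g j T}
    ... | yes (v , t , cv , fresh) = v , t , Extension.reaches (proj₁ g) (proj₂ g) j cv fresh
    ... | no none = ⊥-elim (none candidate)

    Large : ℕ → Fin k → ℕ → Set
    Large m j v = A j v × m ≤ v

    treat : ℕ → Fin k → Config → Config
    treat m j g = offer (offer g j (Large m j)) j (_≡ m)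

    treat-⊑ : ∀ m j g → g ⊑ treat m j g
    treat-⊑ m j g = ⊑-trans (offer-⊑ g j (Large m j)) (offer-⊑ (offer g j (Large m j)) j (_≡ m))

    Achieved : ℕ → Fin k → Config → Set
    Achieved m j g = (Infinite (A j) → ∃ λ v → A j v × m ≤ v × v ∈ proj₁ g j)
                   × (C j m → m ∈ used (proj₁ g))

    achieved-mono : ∀ {m j g g′} → g ⊑ g′ → Achieved m j g → Achieved m j g′
    achieved-mono {j = j} g⊑g′ (inA , covered) =
      (λ infinite → let v , a , m≤v , v∈ = inA infinite
                    in v , a , m≤v , ≼-∈ (prefixes g⊑g′ j) v∈) ,
      (used-mono g⊑g′ ∘ covered)

    treat-achieves : ∀ m j g → Achieved m j (treat m j g)
    treat-achieves m j g = inA , covered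
      where
      g₁ : Config
      g₁ = offer g j (Large m j)
      -- An infinite A_j has a fresh vertex ≥ m, so the first offer succeeds.
      inA : Infinite (A j) → ∃ λ v → A j v × m ≤ v × v ∈ proj₁ (treat m j g) j
      inA infinite with fresh-element em infinite (used (proj₁ g)) m
      ... | v , a , m≤v , fresh with offer-reaches g j (Large m j) (v , (a , m≤v) , A⊆C j v a , fresh)
      ... | w , (a′ , m≤w) , w∈ = w , a′ , m≤w , ≼-∈ (prefixes (offer-⊑ g₁ j (_≡ m)) j) w∈
      -- Vertex m is used already, or is fresh and taken by the second offer.
      covered : C j m → m ∈ used (proj₁ (treat m j g))
      covered cm with m ∈? used (proj₁ g₁)
      ... | yes m∈ = used-mono (offer-⊑ g₁ j (_≡ m)) m∈
      ... | no fresh with offer-reaches g₁ j (_≡ m) (m , refl , cm , fresh)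
      ... | _ , refl , m∈j = ∈-used⁺ (proj₁ (treat m j g)) j m∈j

    treatAll : ℕ → List (Fin k) → Config → Config
    treatAll m [] g = g
    treatAll m (j ∷ js) g = treatAll m js (treat m j g)

    treatAll-⊑ : ∀ m js g → g ⊑ treatAll m js g
    treatAll-⊑ m [] g = ⊑-refl
    treatAll-⊑ m (j ∷ js) g = ⊑-trans (treat-⊑ m j g) (treatAll-⊑ m js (treat m j g))

    treatAll-achieves : ∀ m js g {j} → j ∈ js → Achieved m j (treatAll m js g)
    treatAll-achieves m (j ∷ js) g (here refl) =
      achieved-mono (treatAll-⊑ m js (treat m j g)) (treat-achieves m j g)
    treatAll-achieves m (_ ∷ js) g (there j∈) = treatAll-achieves m js _ j∈

    run : Config → ℕ → Config
    run g zero = g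
    run g (suc m) = treatAll m (allFin k) (run g m)

    run-step : ∀ g m → run g m ⊑ run g (suc m)
    run-step g m = treatAll-⊑ m (allFin k) (run g m)

    run-achieves : ∀ g m j → Achieved m j (run g (suc m))
    run-achieves g m j = treatAll-achieves m (allFin k) (run g m) (∈-allFin j)

    complete : (g : Config) →
      ∃ λ (P : (j : Fin k) → Path G (col j)) →
        GoodPaths G k col C A P × (∀ j {x} → head (proj₁ g j) ≡ just x → FirstPoint G (P j) x)
    complete g = P , (disjointP , meetsA , coversC) , λ j → IsLimit.first (isLimit j)
      where
      T : Fin k → ℕ → List ℕ
      T j n = proj₁ (run g n) j

      T-step : ∀ j n → T j n ≼ T j (suc n)
      T-step j n = prefixes (run-step g n) j

      T-mono : ∀ j {m n} → m ≤ n → T j m ≼ T j n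
      T-mono j = chain-mono (T j) (T-step j)

      limit : ∀ j → Σ (Path G (col j)) (IsLimit (T j))
      limit j = chain-limit em (T j) (λ n → isPath (proj₂ (run g n)) j) (T-step j)

      P : (j : Fin k) → Path G (col j)
      P j = proj₁ (limit j)

      isLimit : ∀ j → IsLimit (T j) (P j)
      isLimit j = proj₂ (limit j)

      -- A common vertex of P j and P j′ would already be common at some stage.
      disjointP : ∀ j j′ → j ≢ j′ → ∀ v → v ∈ₚ P j → v ∈ₚ P j′ → ⊥
      disjointP j j′ j≢j′ v v∈P v∈P′
        with IsLimit.limit⊆stages (isLimit j) v∈P | IsLimit.limit⊆stages (isLimit j′) v∈P′
      ... | a , v∈a | b , v∈b =
        disjoint (proj₂ (run g (a ⊔ b))) j j′ j≢j′ v
          (≼-∈ (T-mono j (m≤m⊔n a b)) v∈a) (≼-∈ (T-mono j′ (m≤n⊔m a b)) v∈b)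

      -- Stage m puts an A_j-vertex ≥ m on P j.
      meetsA : ∀ j → Infinite (A j) → Infinite (λ v → A j v × v ∈ₚ P j)
      meetsA j infinite = unbounded⇒infinite λ m →
        let v , a , m≤v , v∈ = proj₁ (run-achieves g m j) infinite
        in v , (a , IsLimit.stage⊆limit (isLimit j) v∈) , m≤v

      -- Stage v puts v ∈ C_j on some path.
      coversC : ∀ j v → C j v → ∃ λ j′ → v ∈ₚ P j′
      coversC j v cv with ∈-used⁻ (proj₁ (run g (suc v))) (proj₂ (run-achieves g v j) cv)
      ... | j′ , v∈ = j′ , IsLimit.stage⊆limit (isLimit j′) v∈

    empty : Config
    empty = (λ _ → []) , record
      { isPath = λ _ → [] , []
      ; endsInC = λ _ ()
      ; disjoint = λ _ _ _ _ ()
      }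

    seed : {Q : Set} → Dec Q → ℕ → List ℕ
    seed (yes _) x = x ∷ []
    seed (no _) _ = []

    ∈-seed : ∀ {Q} (d : Dec Q) {x v} → v ∈ seed d x → Q × v ≡ x
    ∈-seed (yes q) (here refl) = q , refl

    seed-path : ∀ {Q} (d : Dec Q) x i → IsFinPath G i (seed d x)
    seed-path (yes _) _ _ = [] ∷ [] , [-]
    seed-path (no _) _ _ = [] , []

    seed-head : ∀ {Q} (d : Dec Q) {x} → Q → head (seed d x) ≡ just x
    seed-head (yes _) _ = refl
    seed-head (no ¬q) q = ⊥-elim (¬q q)

    seeded : (x : Fin k → ℕ) → (∀ j → Infinite (C j) → C j (x j)) →
             (∀ j j′ → j ≢ j′ → Infinite (C j) → Infinite (C j′) → x j ≢ x j′) → Config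
    seeded x inC distinct = (λ j → seed em (x j)) , record
      { isPath   = λ j → seed-path em (x j) (col j)
      ; endsInC  = λ j ends → endsInC′ j (∈-seed em (last-∈ _ ends))
      ; disjoint = λ j j′ j≢j′ v v∈ v∈′ → separate j j′ j≢j′ (∈-seed em v∈) (∈-seed em v∈′)
      }
      where
      endsInC′ : ∀ j {u} → Infinite (C j) × u ≡ x j → C j u
      endsInC′ j (infinite , refl) = inC j infinite
      separate : ∀ j j′ {v} → j ≢ j′ →
                 Infinite (C j) × v ≡ x j → Infinite (C j′) × v ≡ x j′ → ⊥
      separate j j′ j≢j′ (infinite , refl) (infinite′ , eq) =
        distinct j j′ j≢j′ infinite infinite′ eq

lemma2p3 : ExcludedMiddle 0ℓ →
    {K : Set} (G : EdgeColouredGraph K) (k : ℕ) (C : Fin k → Subset) (col : Fin k → K) →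
    (∀ j → InfinitelyLinked G (col j) (C j)) →
    (A : Fin k → Subset) → (∀ j → A j ⊆ C j) →
    (∃ λ (P : (j : Fin k) → Path G (col j)) → GoodPaths G k col C A P)
    × ((x : Fin k → ℕ) →
       (∀ j → Infinite (C j) → C j (x j)) →
       (∀ j j′ → j ≢ j′ → Infinite (C j) → Infinite (C j′) → x j ≢ x j′) →
       ∃ λ (P : (j : Fin k) → Path G (col j)) →
         GoodPaths G k col C A P × (∀ j → Infinite (C j) → FirstPoint G (P j) (x j)))
lemma2p3 em G k C col linked A A⊆C =
  (let P , good , _ = complete empty in P , good) ,
  λ x inC distinct →
    let P , good , first = complete (seeded x inC distinct)
    in P , good , λ j infinite → first j (seed-head em infinite)
  where open Construction G em k C col linked A A⊆C
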